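{- Let $G$ be a connected graph, let $T$ be a spanning tree of $G$, let $E'=E(G)\setminus E(T)$, and let $G[E']$ be the subgraph of $G$ induced by the edge set $E'$. Then $\chi'_s(G)\leq \chi'_s(T)+\chi'(G[E'])$.
   Context: Graphs are finite and simple. A proper edge $k$-coloring of $G$ is a vertex distinguishing edge $k$-coloring (vdec) if for any two distinct vertices $u,v$ the set of colors on edges incident to $u$ differs from that of $v$; $\chi'_s(G)$ is the minimum $k$ such that $G$ has a $k$-vdec. $\chi'(H)$ denotes the chromatic index of $H$. The edge-induced subgraph $G[E']$ has edge set $E'$ and vertex set the endpoints of edges in $E'$. -}

module Defs where

open import Data.Nat using (ℕ; zero; suc; _+_; _≤_)
open import Data.Fin using (Fin; zero; suc; inject₁; fromℕ)
open import Data.Bool using (Bool; true; false; _∧_; not)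
open import Data.Product using (Σ; _×_; _,_; ∃)
open import Relation.Binary.PropositionalEquality using (_≡_; _≢_)
open import Relation.Nullary using (¬_)
open import Function.Definitions using (Injective)

record Graph (n : ℕ) : Set where
  field
    adj   : Fin n → Fin n → Bool
    sym   : ∀ u v → adj u v ≡ adj v u
    irref : ∀ u → adj u u ≡ false

open Graph public

Adj : ∀ {n} → Graph n → Fin n → Fin n → Set
Adj G u v = adj G u v ≡ true

data Reach {n : ℕ} (G : Graph n) : Fin n → Fin n → Set where
  here : ∀ {u} → Reach G u u
  step : ∀ {u w v} → Adj G u w → Reach G w v → Reach G u v

Connected : ∀ {n} → Graph n → Set
Connected G = ∀ u v → Reach G u v

record Cycle {n : ℕ} (G : Graph n) : Set where
  field
    len   : ℕ
    f     : Fin (suc (suc (suc len))) → Fin n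
    inj   : Injective _≡_ _≡_ f
    edges : ∀ (i : Fin (suc (suc len))) → Adj G (f (inject₁ i)) (f (suc i))
    close : Adj G (f (fromℕ (suc (suc len)))) (f zero)

Acyclic : ∀ {n} → Graph n → Set
Acyclic G = ¬ Cycle G

IsTree : ∀ {n} → Graph n → Set
IsTree T = Connected T × Acyclic T

_⊆ᴳ_ : ∀ {n} → Graph n → Graph n → Set
T ⊆ᴳ G = ∀ u v → Adj T u v → Adj G u v

IsSpanningTree : ∀ {n} → Graph n → Graph n → Set
IsSpanningTree G T = T ⊆ᴳ G × IsTree T

diffGraph : ∀ {n} → Graph n → Graph n → Graph n
diffGraph {n} G T = record
  { adj = λ u v → adj G u v ∧ not (adj T u v)
  ; sym = λ u v → lemma u v
  ; irref = λ u → irr u }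
  where
  open import Relation.Binary.PropositionalEquality using (cong₂)
  lemma : ∀ u v → (adj G u v ∧ not (adj T u v)) ≡ (adj G v u ∧ not (adj T v u))
  lemma u v = cong₂ (λ a b → a ∧ not b) (Graph.sym G u v) (Graph.sym T u v)
  irr : ∀ u → (adj G u u ∧ not (adj T u u)) ≡ false
  irr u rewrite Graph.irref G u = Relation.Binary.PropositionalEquality.refl

record EdgeColoring {n : ℕ} (G : Graph n) (k : ℕ) : Set where
  field
    col    : ∀ u v → Adj G u v → Fin k
    colSym : ∀ u v (p : Adj G u v) (q : Adj G v u) → col u v p ≡ col v u q

open EdgeColoring public

Proper : ∀ {n k} {G : Graph n} → EdgeColoring G k → Set
Proper {G = G} c = ∀ u v w (p : Adj G u v) (q : Adj G u w) → v ≢ w → col c u v p ≢ col c u w q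

ColorAt : ∀ {n k} {G : Graph n} → EdgeColoring G k → Fin n → Fin k → Set
ColorAt {G = G} c u x = Σ _ λ v → Σ (Adj G u v) λ p → col c u v p ≡ x

SameColorSet : ∀ {n k} {G : Graph n} → EdgeColoring G k → Fin n → Fin n → Set
SameColorSet c u v = ∀ x → (ColorAt c u x → ColorAt c v x) × (ColorAt c v x → ColorAt c u x)

VertexDistinguishing : ∀ {n k} {G : Graph n} → EdgeColoring G k → Set
VertexDistinguishing c = ∀ u v → u ≢ v → ¬ SameColorSet c u v

HasProperEdgeColoring : ∀ {n} → Graph n → ℕ → Set
HasProperEdgeColoring G k = Σ (EdgeColoring G k) Proper

HasVDEC : ∀ {n} → Graph n → ℕ → Set
HasVDEC G k = Σ (EdgeColoring G k) λ c → Proper c × VertexDistinguishing c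

IsChromaticIndex : ∀ {n} → Graph n → ℕ → Set
IsChromaticIndex G k = HasProperEdgeColoring G k × (∀ j → HasProperEdgeColoring G j → k ≤ j)

IsVDChromaticIndex : ∀ {n} → Graph n → ℕ → Set
IsVDChromaticIndex G k = HasVDEC G k × (∀ j → HasVDEC G j → k ≤ j)

VDChromaticIndexAtMost : ∀ {n} → Graph n → ℕ → Set
VDChromaticIndexAtMost G m = Σ ℕ λ j → j ≤ m × IsVDChromaticIndex G j

-- Colour the edges of T by a vertex distinguishing colouring with the
-- colours 0 … s-1, and the remaining edges properly with the colours
-- s … s+c-1.  The palettes are disjoint, so the result is proper; and
-- as T ⊆ G, the low colours at a vertex are exactly its colours in T,
-- so vertices distinguished in T stay distinguished in G.  The exact value
-- χ'_s(G) ≤ s + c exists because having a k-vdec is decidable: a colouring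
-- is determined by a finite table of colours.
module Submission where

open import Defs hiding (sym)
open import Data.Nat using (ℕ; zero; suc; _+_; _≤_; _<_; s≤s⁻¹)
open import Data.Nat.Properties using (≮⇒≥; n<1+n; m<n⇒m<1+n; m<1+n⇒m<n∨m≡n)
open import Data.Fin using (Fin; zero; suc; _↑ˡ_; _↑ʳ_; splitAt)
open import Data.Fin.Properties using (↑ˡ-injective; ↑ʳ-injective; splitAt-↑ˡ; splitAt-↑ʳ; any?; all?)
  renaming (_≟_ to _≟ᶠ_)
open import Data.Bool using (true; false)
open import Data.Bool.Properties using (¬-not) renaming (_≟_ to _≟ᵇ_)
open import Data.Empty using (⊥-elim)
open import Data.Product using (Σ; _×_; _,_; ∃; proj₁; proj₂)
open import Data.Sum using (_⊎_; inj₁; inj₂; [_,_]′)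
open import Data.Vec using (Vec; []; _∷_; lookup; tabulate)
open import Data.Vec.Properties using (lookup∘tabulate)
open import Function using (_∘_; id)
open import Level using (0ℓ)
open import Relation.Binary.PropositionalEquality using (_≡_; _≢_; refl; sym; trans; cong; module ≡-Reasoning)
open import Relation.Nullary using (¬_; Dec; yes; no; contradiction)
open import Relation.Nullary.Decidable using (map′; _×-dec_; _→-dec_; ¬?)
open import Relation.Unary using (Pred; Decidable)
import Axiom.UniquenessOfIdentityProofs as UIP

private
  variable
    n j k s c : ℕ

Adj-irrelevant : (G : Graph n) {u v : Fin n} (p q : Adj G u v) → p ≡ q
Adj-irrelevant G = UIP.Decidable⇒UIP.≡-irrelevant _≟ᵇ_

Adj-sym : (G : Graph n) {u v : Fin n} → Adj G u v → Adj G v u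
Adj-sym G {u} {v} p = trans (Graph.sym G v u) p

Adj? : (G : Graph n) (u v : Fin n) → Dec (Adj G u v)
Adj? G u v = adj G u v ≟ᵇ true

col-irrelevant : {G : Graph n} (c : EdgeColoring G k) {u v : Fin n} (p q : Adj G u v) →
                 col c u v p ≡ col c u v q
col-irrelevant {G = G} c p q = cong (col c _ _) (Adj-irrelevant G p q)

↑ˡ≢↑ʳ : ∀ {m n} (i : Fin m) (j : Fin n) → i ↑ˡ n ≢ m ↑ʳ j
↑ˡ≢↑ʳ {m} {n} i j eq with trans (sym (splitAt-↑ˡ m i n)) (trans (cong (splitAt m) eq) (splitAt-↑ʳ m n j))
... | ()

VertexDistinguishing-transfer :
  {G H : Graph n} {c : EdgeColoring G j} {d : EdgeColoring H k} (ι : Fin j → Fin k) →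
  (∀ u x → ColorAt c u x → ColorAt d u (ι x)) →
  (∀ u x → ColorAt d u (ι x) → ColorAt c u x) →
  VertexDistinguishing c → VertexDistinguishing d
VertexDistinguishing-transfer ι to from vd u v u≢v same = vd u v u≢v λ x →
  from v x ∘ proj₁ (same (ι x)) ∘ to u x , from u x ∘ proj₂ (same (ι x)) ∘ to v x

module _ {G : Graph n} where

  _≈ᶜ_ : EdgeColoring G k → EdgeColoring G k → Set
  c ≈ᶜ d = ∀ u v p → col c u v p ≡ col d u v p

  Proper-resp : {c d : EdgeColoring G k} → c ≈ᶜ d → Proper c → Proper d
  Proper-resp c≈d proper u v w p q v≢w eq =
    proper u v w p q v≢w (trans (c≈d u v p) (trans eq (sym (c≈d u w q))))

  ColorAt-resp : {c d : EdgeColoring G k} → c ≈ᶜ d → ∀ u x → ColorAt c u x → ColorAt d u x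
  ColorAt-resp c≈d u x (w , p , eq) = w , p , trans (sym (c≈d u w p)) eq

  VertexDistinguishing-resp : {c d : EdgeColoring G k} → c ≈ᶜ d →
                              VertexDistinguishing c → VertexDistinguishing d
  VertexDistinguishing-resp {c = c} {d} c≈d = VertexDistinguishing-transfer {c = c} {d} id
    (ColorAt-resp {c = c} {d} c≈d) (ColorAt-resp {c = d} {c} λ u v p → sym (c≈d u v p))

module _ {G T : Graph n} {u v : Fin n} where

  Adj-diff : Adj G u v → ¬ Adj T u v → Adj (diffGraph G T) u v
  Adj-diff uv uv∉T rewrite uv | ¬-not uv∉T = refl

  Adj-diff⇒¬Adj : Adj (diffGraph G T) u v → ¬ Adj T u v
  Adj-diff⇒¬Adj uv∈D uv∈T with adj G u v | adj T u v
  Adj-diff⇒¬Adj () uv∈T | false | _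
  Adj-diff⇒¬Adj () uv∈T | true  | true
  Adj-diff⇒¬Adj _  ()   | true  | false

  edge-split : Adj G u v → Adj T u v ⊎ Adj (diffGraph G T) u v
  edge-split uv with Adj? T u v
  ... | yes uv∈T = inj₁ uv∈T
  ... | no  uv∉T = inj₂ (Adj-diff uv uv∉T)

module Join {G T : Graph n} (T⊆G : T ⊆ᴳ G)
            (cT : EdgeColoring T s) (cD : EdgeColoring (diffGraph G T) c) where

  private
    D = diffGraph G T

    split : {u v : Fin n} → Adj G u v → Adj T u v ⊎ Adj D u v
    split = edge-split {G = G} {T = T}

  colour : {u v : Fin n} → Adj T u v ⊎ Adj D u v → Fin (s + c)
  colour (inj₁ uv∈T) = col cT _ _ uv∈T ↑ˡ c
  colour (inj₂ uv∈D) = s ↑ʳ col cD _ _ uv∈D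

  colour-T : {u v : Fin n} (e : Adj T u v ⊎ Adj D u v) (uv∈T : Adj T u v) →
             colour e ≡ col cT u v uv∈T ↑ˡ c
  colour-T (inj₁ p) uv∈T = cong (_↑ˡ c) (col-irrelevant cT p uv∈T)
  colour-T (inj₂ p) uv∈T = contradiction uv∈T (Adj-diff⇒¬Adj {G = G} {T} p)

  colour-D : {u v : Fin n} (e : Adj T u v ⊎ Adj D u v) (uv∈D : Adj D u v) →
             colour e ≡ s ↑ʳ col cD u v uv∈D
  colour-D (inj₁ p) uv∈D = contradiction p (Adj-diff⇒¬Adj {G = G} {T} uv∈D)
  colour-D (inj₂ p) uv∈D = cong (s ↑ʳ_) (col-irrelevant cD p uv∈D)

  joinCol : ∀ u v → Adj G u v → Fin (s + c)
  joinCol u v uv = colour (split uv)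

  joinCol-sym : ∀ u v (p : Adj G u v) (q : Adj G v u) → joinCol u v p ≡ joinCol v u q
  joinCol-sym u v p q with split p
  ... | inj₁ uv∈T = begin
    colour (inj₁ uv∈T)                     ≡⟨ cong (_↑ˡ c) (colSym cT u v uv∈T vu∈T) ⟩
    col cT v u vu∈T ↑ˡ c                   ≡⟨ colour-T (split q) vu∈T ⟨
    joinCol v u q                          ∎
    where open ≡-Reasoning
          vu∈T = Adj-sym T uv∈T
  ... | inj₂ uv∈D = begin
    colour (inj₂ uv∈D)                     ≡⟨ cong (s ↑ʳ_) (colSym cD u v uv∈D vu∈D) ⟩
    s ↑ʳ col cD v u vu∈D                   ≡⟨ colour-D (split q) vu∈D ⟨
    joinCol v u q                          ∎
    where open ≡-Reasoning
          vu∈D = Adj-sym D uv∈D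

  joined : EdgeColoring G (s + c)
  joined = record { col = joinCol ; colSym = joinCol-sym }

  joined-proper : Proper cT → Proper cD → Proper joined
  joined-proper properT properD u v w p q v≢w eq with split p | split q
  ... | inj₁ uv∈T | inj₁ uw∈T = properT u v w uv∈T uw∈T v≢w (↑ˡ-injective c _ _ eq)
  ... | inj₂ uv∈D | inj₂ uw∈D = properD u v w uv∈D uw∈D v≢w (↑ʳ-injective s _ _ eq)
  ... | inj₁ _    | inj₂ _    = ↑ˡ≢↑ʳ _ _ eq
  ... | inj₂ _    | inj₁ _    = ↑ˡ≢↑ʳ _ _ (sym eq)

  ColorAt-↑ˡ : ∀ u x → ColorAt cT u x → ColorAt joined u (x ↑ˡ c)
  ColorAt-↑ˡ u x (w , uw∈T , eq) =
    w , T⊆G u w uw∈T , trans (colour-T (split (T⊆G u w uw∈T)) uw∈T) (cong (_↑ˡ c) eq)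

  ColorAt-↑ˡ⁻¹ : ∀ u x → ColorAt joined u (x ↑ˡ c) → ColorAt cT u x
  ColorAt-↑ˡ⁻¹ u x (w , uw , eq) with split uw
  ... | inj₁ uw∈T = w , uw∈T , ↑ˡ-injective c _ _ eq
  ... | inj₂ _    = contradiction (sym eq) (↑ˡ≢↑ʳ _ _)

HasVDEC-extend : {G T : Graph n} → T ⊆ᴳ G → HasVDEC T s →
                 HasProperEdgeColoring (diffGraph G T) c → HasVDEC G (s + c)
HasVDEC-extend {c = c} T⊆G (cT , properT , vdT) (cD , properD) =
  joined , joined-proper properT properD ,
  VertexDistinguishing-transfer {c = cT} {joined} (_↑ˡ c) ColorAt-↑ˡ ColorAt-↑ˡ⁻¹ vdT
  where open Join T⊆G cT cD

Searchable : Set → Set₁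
Searchable A = {P : Pred A 0ℓ} → Decidable P → Dec (∃ P)

Vec-searchable : {A : Set} → Searchable A → ∀ m → Searchable (Vec A m)
Vec-searchable search zero    P? = map′ ([] ,_) (λ { ([] , p) → p }) (P? [])
Vec-searchable search (suc m) P? =
  map′ (λ (a , as , p) → a ∷ as , p) (λ { (a ∷ as , p) → a , as , p })
       (search λ a → Vec-searchable search m (P? ∘ (a ∷_)))

module _ (G : Graph n) (f : Fin n → Fin n → Fin k) where

  SymmetricOnEdges : Set
  SymmetricOnEdges = ∀ u v → Adj G u v → f u v ≡ f v u

  tableColoring : SymmetricOnEdges → EdgeColoring G k
  tableColoring f-sym = record { col = λ u v _ → f u v ; colSym = λ u v p _ → f-sym u v p }

  IsVDTable : Set
  IsVDTable = Σ SymmetricOnEdges λ f-sym →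
    Proper (tableColoring f-sym) × VertexDistinguishing (tableColoring f-sym)

  IsVDTable? : Dec IsVDTable
  IsVDTable? with all? (λ u → all? λ v → Adj? G u v →-dec (f u v ≟ᶠ f v u))
  ... | no ¬f-sym = no (¬f-sym ∘ proj₁)
  -- properness and distinguishing of tableColoring ignore the symmetry proof
  ... | yes f-sym = map′ (f-sym ,_) proj₂ (proper? ×-dec vd?)
    where
    proper? : Dec (Proper (tableColoring f-sym))
    proper? = all? λ u → all? λ v → all? λ w → Adj? G u v →-dec (Adj? G u w →-dec
                (¬? (v ≟ᶠ w) →-dec ¬? (f u v ≟ᶠ f u w)))
    colorAt? : ∀ u x → Dec (ColorAt (tableColoring f-sym) u x)
    colorAt? u x = any? λ w → Adj? G u w ×-dec (f u w ≟ᶠ x)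
    vd? : Dec (VertexDistinguishing (tableColoring f-sym))
    vd? = all? λ u → all? λ v → ¬? (u ≟ᶠ v) →-dec ¬? (all? λ x →
            (colorAt? u x →-dec colorAt? v x) ×-dec (colorAt? v x →-dec colorAt? u x))

Table : ℕ → ℕ → Set
Table n k = Vec (Vec (Fin k) n) n

entry : Table n k → Fin n → Fin n → Fin k
entry t u v = lookup (lookup t u) v

module _ {G : Graph n} (c : EdgeColoring G (suc k)) where

  -- non-edges get the dummy colour zero, which is why k + 1 colours are needed
  colourOrZero : {u v : Fin n} → Dec (Adj G u v) → Fin (suc k)
  colourOrZero (yes uv) = col c _ _ uv
  colourOrZero (no  _)  = zero

  colourOrZero-yes : {u v : Fin n} (d : Dec (Adj G u v)) (uv : Adj G u v) → colourOrZero d ≡ col c u v uv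
  colourOrZero-yes (yes uv′) uv = col-irrelevant c uv′ uv
  colourOrZero-yes (no ¬uv)  uv = contradiction uv ¬uv

  colourTable : Table n (suc k)
  colourTable = tabulate λ u → tabulate λ v → colourOrZero (Adj? G u v)

  entry-colourTable : ∀ u v (uv : Adj G u v) → entry colourTable u v ≡ col c u v uv
  entry-colourTable u v uv = begin
    lookup (lookup colourTable u) v   ≡⟨ cong (λ r → lookup r v) (lookup∘tabulate _ u) ⟩
    lookup (tabulate _) v             ≡⟨ lookup∘tabulate _ v ⟩
    colourOrZero (Adj? G u v)         ≡⟨ colourOrZero-yes (Adj? G u v) uv ⟩
    col c u v uv                      ∎
    where open ≡-Reasoning

  colourTable-symmetric : SymmetricOnEdges G (entry colourTable)
  colourTable-symmetric u v uv = begin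
    entry colourTable u v   ≡⟨ entry-colourTable u v uv ⟩
    col c u v uv            ≡⟨ colSym c u v uv (Adj-sym G uv) ⟩
    col c v u _             ≡⟨ entry-colourTable v u (Adj-sym G uv) ⟨
    entry colourTable v u   ∎
    where open ≡-Reasoning

  colourTable-≈ : c ≈ᶜ tableColoring G (entry colourTable) colourTable-symmetric
  colourTable-≈ u v uv = sym (entry-colourTable u v uv)

HasVDEC-suc? : (G : Graph n) (k : ℕ) → Dec (HasVDEC G (suc k))
HasVDEC-suc? {n} G k = map′ fromTable toTable
  (Vec-searchable (Vec-searchable any? n) n λ t → IsVDTable? G (entry t))
  where
  fromTable : ∃ (λ t → IsVDTable G (entry t)) → HasVDEC G (suc k)
  fromTable (t , f-sym , proper , vd) = tableColoring G (entry t) f-sym , proper , vd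
  toTable : HasVDEC G (suc k) → ∃ (λ (t : Table n (suc k)) → IsVDTable G (entry t))
  toTable (c , proper , vd) = colourTable c , colourTable-symmetric c ,
    Proper-resp {c = c} {tabled} (colourTable-≈ c) proper ,
    VertexDistinguishing-resp {c = c} {tabled} (colourTable-≈ c) vd
    where tabled = tableColoring G (entry (colourTable c)) (colourTable-symmetric c)

-- With no colours there are no edges and every colour set is empty, so a
-- 0-vdec exists exactly when there is at most one vertex.
HasVDEC-zero? : (G : Graph n) → Dec (HasVDEC G 0)
HasVDEC-zero? {zero}        G = yes (record { col = λ () ; colSym = λ () } , (λ ()) , λ ())
HasVDEC-zero? {suc zero}    G = yes (noColours , (λ u v w p → ⊥-elim (noEdge u v p)) ,
                                     λ { zero zero 0≢0 → contradiction refl 0≢0 })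
  where
  noEdge : ∀ u v → ¬ Adj G u v
  noEdge zero zero p with trans (sym p) (irref G zero)
  ... | ()
  noColours : EdgeColoring G 0
  noColours = record { col = λ u v p → ⊥-elim (noEdge u v p) ; colSym = λ u v p _ → ⊥-elim (noEdge u v p) }
HasVDEC-zero? {suc (suc n)} G = no λ (c , _ , vd) → vd zero (suc zero) (λ ()) (λ ())

HasVDEC? : (G : Graph n) (k : ℕ) → Dec (HasVDEC G k)
HasVDEC? G zero    = HasVDEC-zero? G
HasVDEC? G (suc k) = HasVDEC-suc? G k

Least : Pred ℕ 0ℓ → ℕ → Set
Least P m = P m × (∀ k → P k → m ≤ k)

module _ {P : Pred ℕ 0ℓ} (P? : Decidable P) where

  least-or-none : ∀ N → (∃ λ m → m < N × Least P m) ⊎ (∀ k → k < N → ¬ P k)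
  least-or-none zero = inj₂ λ _ ()
  least-or-none (suc N) with least-or-none N
  ... | inj₁ (m , m<N , least) = inj₁ (m , m<n⇒m<1+n m<N , least)
  ... | inj₂ none with P? N
  ...   | yes pN = inj₁ (N , n<1+n N , pN , λ k pk → ≮⇒≥ λ k<N → none k k<N pk)
  ...   | no ¬pN = inj₂ λ k k<1+N → [ none k , (λ { refl → ¬pN }) ]′ (m<1+n⇒m<n∨m≡n k<1+N)

  least-≤ : ∀ N → P N → ∃ λ m → m ≤ N × Least P m
  least-≤ N pN with least-or-none (suc N)
  ... | inj₁ (m , m<1+N , least) = m , s≤s⁻¹ m<1+N , least
  ... | inj₂ none                = contradiction pN (none N (n<1+n N))

corollary2 : ∀ {n : ℕ} (G T : Graph n) → Connected G → IsSpanningTree G T →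
    ∀ (s c : ℕ) → IsVDChromaticIndex T s → IsChromaticIndex (diffGraph G T) c →
    VDChromaticIndexAtMost G (s + c)
corollary2 G T _ (T⊆G , _) s c (vdecT , _) (colouringD , _) =
  least-≤ (HasVDEC? G) (s + c) (HasVDEC-extend T⊆G vdecT colouringD)
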